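{- Every finite tree $T$ with maximum degree $\Delta(T)\ge 3$ and with $s$ leaves contains $\lfloor s/(2\Delta(T))\rfloor$ pairwise vertex-disjoint subtrees each of which contains three leaves of $T$. -}

module Defs where

open import Data.Nat using (ℕ; zero; suc; _+_; _*_; _≤_; _⊔_; NonZero; s≤s; z≤n)
open import Data.Fin using (Fin)
import Data.Fin as F
open import Data.Bool using (Bool; true; false; if_then_else_)
open import Data.List using (List; []; _∷_; _++_; length)
open import Data.List.Relation.Unary.Unique.Propositional using (Unique)
open import Data.List.Relation.Unary.Linked using (Linked)
open import Data.Product using (Σ; ∃; _×_; _,_)
open import Relation.Binary.PropositionalEquality using (_≡_; _≢_)
open import Relation.Nullary using (¬_)
open import Data.Nat.Base using (NonZero)

record Graph : Set where
  field
    n      : ℕ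
    adj    : Fin n → Fin n → Bool
    sym    : ∀ u v → adj u v ≡ adj v u
    irrefl : ∀ v → adj v v ≡ false
open Graph public

VSet : ℕ → Set
VSet n = Fin n → Bool

_∈ᵥ_ : ∀ {n} → Fin n → VSet n → Set
v ∈ᵥ S = S v ≡ true

count : ∀ {n} → (Fin n → Bool) → ℕ
count {zero}  f = 0
count {suc n} f = (if f F.zero then 1 else 0) + count (λ i → f (F.suc i))

-- maximum of a function over Fin n (0 if n = 0)
maxOver : ∀ {n} → (Fin n → ℕ) → ℕ
maxOver {zero}  f = 0
maxOver {suc n} f = f F.zero ⊔ maxOver (λ i → f (F.suc i))

degree : (G : Graph) → Fin (n G) → ℕ
degree G v = count (adj G v)

maxDegree : Graph → ℕ
maxDegree G = maxOver (degree G)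

isLeaf : (G : Graph) → Fin (n G) → Bool
isLeaf G v with degree G v
... | 1 = true
... | _ = false

leafCount : Graph → ℕ
leafCount G = count (isLeaf G)

data Walk (G : Graph) (S : VSet (n G)) : Fin (n G) → Fin (n G) → Set where
  here : ∀ {u} → u ∈ᵥ S → Walk G S u u
  step : ∀ {u w v} → u ∈ᵥ S → adj G u w ≡ true → Walk G S w v → Walk G S u v

ConnectedOn : (G : Graph) → VSet (n G) → Set
ConnectedOn G S = ∀ u v → u ∈ᵥ S → v ∈ᵥ S → Walk G S u v

Connected : Graph → Set
Connected G = ConnectedOn G (λ _ → true)

Adj : (G : Graph) → Fin (n G) → Fin (n G) → Set
Adj G u v = adj G u v ≡ true

-- a cycle v, v₁, …, vₖ, v with k ≥ 2 and all listed vertices distinct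
IsCycle : (G : Graph) → Fin (n G) → List (Fin (n G)) → Set
IsCycle G v vs = (2 ≤ length vs) × Unique (v ∷ vs) × Linked (Adj G) (v ∷ vs ++ v ∷ [])

Acyclic : Graph → Set
Acyclic G = ∀ v vs → ¬ IsCycle G v vs

IsTree : Graph → Set
IsTree G = Connected G × Acyclic G

IsSubtree : (G : Graph) → VSet (n G) → Set
IsSubtree G S = (∃ λ v → v ∈ᵥ S) × ConnectedOn G S

ContainsThreeLeaves : (G : Graph) → VSet (n G) → Set
ContainsThreeLeaves G S = 3 ≤ count (λ v → if S v then isLeaf G v else false)

PairwiseDisjoint : ∀ {k m} → (Fin k → VSet m) → Set
PairwiseDisjoint {k} {m} T = ∀ (i j : Fin k) → i ≢ j → ∀ (v : Fin m) → ¬ (v ∈ᵥ T i × v ∈ᵥ T j)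

-- 2d is nonzero when d ≥ 3 (used to form ⌊s / (2Δ)⌋)
nz2 : ∀ {d} → 3 ≤ d → NonZero (2 * d)
nz2 (s≤s _) = _

module Submission where

-- Fix a spanning tree of
-- T rooted at some vertex, and process it bottom-up, greedily.  At every
-- vertex r the unused ("residual") parts of the children of r, each connected
-- to its child's root and containing at most two leaves of T, are glued
-- together through r.  If the glued set contains three leaves of T it is cut
-- off as a new part; otherwise it becomes the residual part of r.  A glued
-- set collects at most 2·(number of children of r) ≤ 2Δ leaves (at most three
-- when r itself is a leaf), so every part accounts for at most 2Δ leaves and
-- s ≤ 2Δ·k + 2 < 2Δ·(k + 1) for the number k of parts found.  Hence
-- ⌊s/(2Δ)⌋ ≤ k, and the first ⌊s/(2Δ)⌋ parts are the required subtrees.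

open import Defs hiding (sym)
open import Data.Nat using (ℕ; zero; suc; _+_; _*_; _≤_; _<_; _/_; s≤s; z≤n; _≤?_; s≤s⁻¹)
open import Data.Nat.Properties
open import Data.Nat.DivMod using (m<n*o⇒m/o<n)
open import Data.Nat.Tactic.RingSolver using (solve-∀)
open import Data.Fin as F using (Fin; zero; suc; inject≤)
open import Data.Fin.Properties using (all?; ¬∀⟶∃¬; inject≤-injective)
open import Data.Bool as B using (Bool; true; false; if_then_else_; _∨_)
open import Data.Bool.Properties using (∨-assoc; ∨-comm; ∨-identityʳ; ∨-zeroʳ; ∨-idem; ∨-conicalˡ; ∨-conicalʳ; ¬-not)
open import Data.List using (List; []; _∷_; _++_; length; lookup)
open import Data.List.Properties using (length-++)
open import Data.List.Relation.Unary.All as All using (All; []; _∷_)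
open import Data.List.Relation.Unary.AllPairs using (AllPairs; []; _∷_)
import Data.List.Relation.Unary.All.Properties as AllProps
import Data.List.Relation.Unary.AllPairs.Properties as AllPairsProps
open import Data.List.Membership.Propositional.Properties using (∈-lookup)
open import Data.Product using (Σ; _×_; _,_)
open import Data.Sum using (_⊎_; inj₁; inj₂)
open import Data.Empty using (⊥; ⊥-elim)
open import Relation.Binary.PropositionalEquality
open import Relation.Nullary using (yes; no; does; Dec)
open import Relation.Nullary.Decidable using (dec-true; dec-false)

private
  variable
    m : ℕ
    A B C A′ B′ : VSet m

-- The set operations are opaque, so that statements about them
-- are read (and unified) at the level of sets rather than of Booleans; the
-- block below records the properties of ∅, ∪ and singletons that are used.

infixr 6 _∪_
infix 4 _⊆_ _≐_

_⊆_ : VSet m → VSet m → Set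
A ⊆ B = ∀ v → v ∈ᵥ A → v ∈ᵥ B

_≐_ : VSet m → VSet m → Set
A ≐ B = ∀ v → A v ≡ B v

Disjoint : VSet m → VSet m → Set
Disjoint A B = ∀ v → v ∈ᵥ A → v ∈ᵥ B → ⊥

∈-∉ : ∀ {b : Bool} → b ≡ true → b ≡ false → ⊥
∈-∉ b≡true b≡false with () ← trans (sym b≡true) b≡false

count-none : (A : VSet m) → (∀ v → A v ≡ false) → count A ≡ 0
count-none {zero}  A A-empty = refl
count-none {suc m} A A-empty rewrite A-empty zero = count-none (λ i → A (suc i)) (λ i → A-empty (suc i))

count-cong : A ≐ B → count A ≡ count B
count-cong {zero}  A≐B = refl
count-cong {suc m} A≐B =
  cong₂ _+_ (cong (λ b → if b then 1 else 0) (A≐B zero)) (count-cong (λ i → A≐B (suc i)))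

count-≤ : (A : VSet m) → count A ≤ m
count-≤ {zero}  A = z≤n
count-≤ {suc m} A with A zero
... | true  = s≤s (count-≤ (λ i → A (suc i)))
... | false = m≤n⇒m≤1+n (count-≤ (λ i → A (suc i)))

count-mono : A ⊆ B → count A ≤ count B
count-mono {zero}          A⊆B = z≤n
count-mono {suc m} {A} {B} A⊆B with A zero in a | B zero in b
... | true  | true  = s≤s (count-mono (λ i → A⊆B (suc i)))
... | true  | false = ⊥-elim (∈-∉ (A⊆B zero a) b)
... | false | true  = m≤n⇒m≤1+n (count-mono (λ i → A⊆B (suc i)))
... | false | false = count-mono (λ i → A⊆B (suc i))

opaque

  ∅ : VSet m
  ∅ _ = false

  _∪_ : VSet m → VSet m → VSet m
  (A ∪ B) v = A v ∨ B v

  ⟦_⟧ : Fin m → VSet m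
  ⟦ r ⟧ v = does (r F.≟ v)

  ∉-∅ : ∀ {v : Fin m} → ∅ v ≡ false
  ∉-∅ = refl

  ∪-apply : ∀ {v : Fin m} → (A ∪ B) v ≡ A v ∨ B v
  ∪-apply = refl

  ∪-introˡ : ∀ {v : Fin m} → v ∈ᵥ A → v ∈ᵥ (A ∪ B)
  ∪-introˡ {B = B} {v} v∈A = subst (λ a → a ∨ B v ≡ true) (sym v∈A) refl

  ∪-introʳ : ∀ {v : Fin m} → v ∈ᵥ B → v ∈ᵥ (A ∪ B)
  ∪-introʳ {A = A} {v = v} v∈B = subst (λ b → A v ∨ b ≡ true) (sym v∈B) (∨-zeroʳ (A v))

  ∪-elim : ∀ {v : Fin m} → v ∈ᵥ (A ∪ B) → v ∈ᵥ A ⊎ v ∈ᵥ B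
  ∪-elim {A = A} {v = v} v∈A∪B with A v
  ... | true  = inj₁ refl
  ... | false = inj₂ v∈A∪B

  ∉-∪ : ∀ {v : Fin m} → A v ≡ false → B v ≡ false → (A ∪ B) v ≡ false
  ∉-∪ {B = B} {v} v∉A v∉B = subst (λ a → a ∨ B v ≡ false) (sym v∉A) v∉B

  ∉-∪ˡ : ∀ {v : Fin m} → (A ∪ B) v ≡ false → A v ≡ false
  ∉-∪ˡ {A = A} {B} {v} = ∨-conicalˡ (A v) (B v)

  ∉-∪ʳ : ∀ {v : Fin m} → (A ∪ B) v ≡ false → B v ≡ false
  ∉-∪ʳ {A = A} {B} {v} = ∨-conicalʳ (A v) (B v)

  ∈-⟦⟧ : ∀ (r : Fin m) → r ∈ᵥ ⟦ r ⟧
  ∈-⟦⟧ r = dec-true (r F.≟ r) refl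

  ⟦⟧-elim : ∀ {r v : Fin m} → v ∈ᵥ ⟦ r ⟧ → r ≡ v
  ⟦⟧-elim {r = r} {v} v∈⟦r⟧ with r F.≟ v
  ... | yes r≡v = r≡v

  ∉-⟦⟧ : ∀ {r v : Fin m} → r ≢ v → ⟦ r ⟧ v ≡ false
  ∉-⟦⟧ {r = r} {v} = dec-false (r F.≟ v)

  ∪-identityʳ : A ∪ ∅ ≐ A
  ∪-identityʳ {A = A} v = ∨-identityʳ (A v)

  ∪-assoc : (A ∪ B) ∪ C ≐ A ∪ (B ∪ C)
  ∪-assoc {A = A} {B} {C} v = ∨-assoc (A v) (B v) (C v)

  ∪-comm : A ∪ B ≐ B ∪ A
  ∪-comm {A = A} {B} v = ∨-comm (A v) (B v)

  ∪-cong : A ≐ A′ → B ≐ B′ → A ∪ B ≐ A′ ∪ B′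
  ∪-cong A≐A′ B≐B′ v = cong₂ _∨_ (A≐A′ v) (B≐B′ v)

  count-∪ : Disjoint A B → count (A ∪ B) ≡ count A + count B
  count-∪ {zero}          A#B = refl
  count-∪ {suc m} {A} {B} A#B with A zero in a | B zero in b
  ... | true  | true  = ⊥-elim (A#B zero a b)
  ... | true  | false = cong suc (count-∪ (λ i → A#B (suc i)))
  ... | false | true  = trans (cong suc (count-∪ (λ i → A#B (suc i)))) (sym (+-suc _ _))
  ... | false | false = count-∪ (λ i → A#B (suc i))

  count-⟦⟧ : ∀ (r : Fin m) → count ⟦ r ⟧ ≡ 1
  count-⟦⟧ {suc m} zero    = cong suc (count-none {m} ∅ (λ _ → refl))
  count-⟦⟧ {suc m} (suc r) = count-⟦⟧ r

⊆-refl : A ⊆ A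
⊆-refl _ v∈A = v∈A

≐-refl : A ≐ A
≐-refl _ = refl

≐-sym : A ≐ B → B ≐ A
≐-sym A≐B v = sym (A≐B v)

≐-trans : A ≐ B → B ≐ C → A ≐ C
≐-trans A≐B B≐C v = trans (A≐B v) (B≐C v)

∪-swap : (A ∪ B) ∪ C ≐ (A ∪ C) ∪ B
∪-swap = ≐-trans ∪-assoc (≐-trans (∪-cong ≐-refl ∪-comm) (≐-sym ∪-assoc))

≐⇒⊆ : A ≐ B → A ⊆ B
≐⇒⊆ A≐B v v∈A = trans (sym (A≐B v)) v∈A

⊆-trans : A ⊆ B → B ⊆ C → A ⊆ C
⊆-trans A⊆B B⊆C v v∈A = B⊆C v (A⊆B v v∈A)

∅-⊆ : ∅ ⊆ A
∅-⊆ v v∈∅ = ⊥-elim (∈-∉ v∈∅ ∉-∅)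

⊆-∪ˡ : A ⊆ A ∪ B
⊆-∪ˡ _ = ∪-introˡ

⊆-∪ʳ : B ⊆ A ∪ B
⊆-∪ʳ _ = ∪-introʳ

∪-⊆ : A ⊆ C → B ⊆ C → A ∪ B ⊆ C
∪-⊆ A⊆C B⊆C v v∈A∪B with ∪-elim v∈A∪B
... | inj₁ v∈A = A⊆C v v∈A
... | inj₂ v∈B = B⊆C v v∈B

∪-elimʳ : ∀ {v : Fin m} → v ∈ᵥ (A ∪ B) → A v ≡ false → v ∈ᵥ B
∪-elimʳ v∈A∪B v∉A with ∪-elim v∈A∪B
... | inj₁ v∈A = ⊥-elim (∈-∉ v∈A v∉A)
... | inj₂ v∈B = v∈B

∉-⊆ : ∀ {v : Fin m} → A ⊆ B → B v ≡ false → A v ≡ false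
∉-⊆ {A = A} {v = v} A⊆B v∉B with A v in v∈A
... | true  = ⊥-elim (∈-∉ (A⊆B v v∈A) v∉B)
... | false = refl

Disjoint-sym : Disjoint A B → Disjoint B A
Disjoint-sym A#B v v∈B v∈A = A#B v v∈A v∈B

Disjoint-⊆ : A ⊆ A′ → B ⊆ B′ → Disjoint A′ B′ → Disjoint A B
Disjoint-⊆ A⊆A′ B⊆B′ A′#B′ v v∈A v∈B = A′#B′ v (A⊆A′ v v∈A) (B⊆B′ v v∈B)

Disjoint-∪ : Disjoint A B → Disjoint A C → Disjoint A (B ∪ C)
Disjoint-∪ A#B A#C v v∈A v∈B∪C with ∪-elim v∈B∪C
... | inj₁ v∈B = A#B v v∈A v∈B
... | inj₂ v∈C = A#C v v∈A v∈C

Disjoint-∅ : Disjoint A ∅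
Disjoint-∅ v _ v∈∅ = ∈-∉ v∈∅ ∉-∅

⟦⟧-⊆ : ∀ {r : Fin m} → r ∈ᵥ A → ⟦ r ⟧ ⊆ A
⟦⟧-⊆ {A = A} r∈A v v∈⟦r⟧ = subst (_∈ᵥ A) (⟦⟧-elim v∈⟦r⟧) r∈A

Disjoint-⟦⟧ : ∀ {r : Fin m} → A r ≡ false → Disjoint A ⟦ r ⟧
Disjoint-⟦⟧ {A = A} r∉A v v∈A v∈⟦r⟧ = ∈-∉ (subst (_∈ᵥ A) (sym (⟦⟧-elim v∈⟦r⟧)) v∈A) r∉A

count-extend : ∀ {b : Fin m} → A b ≡ false → count (A ∪ ⟦ b ⟧) ≡ suc (count A)
count-extend {A = A} {b = b} b∉A = begin
  count (A ∪ ⟦ b ⟧)     ≡⟨ count-∪ {A = A} {B = ⟦ b ⟧} (Disjoint-⟦⟧ b∉A) ⟩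
  count A + count ⟦ b ⟧ ≡⟨ cong (count A +_) (count-⟦⟧ b) ⟩
  count A + 1           ≡⟨ +-comm (count A) 1 ⟩
  suc (count A)         ∎
  where open ≡-Reasoning

element-of-positive-max : (f : Fin m → ℕ) → 1 ≤ maxOver f → Fin m
element-of-positive-max {suc m} f _ = zero

maxOver-≥ : (f : Fin m → ℕ) (i : Fin m) → f i ≤ maxOver f
maxOver-≥ f zero    = m≤m⊔n _ _
maxOver-≥ f (suc i) = ≤-trans (maxOver-≥ (λ j → f (suc j)) i) (m≤n⊔m _ _)

AllPairs-lookup : ∀ {X : Set} {R : X → X → Set} → (∀ {x y} → R x y → R y x) →
  ∀ {xs} → AllPairs R xs → (i j : Fin (length xs)) → i ≢ j → R (lookup xs i) (lookup xs j)
AllPairs-lookup R-sym (_  ∷ _)   zero    zero    i≢j = ⊥-elim (i≢j refl)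
AllPairs-lookup R-sym (Rx ∷ _)   zero    (suc j) _   = All.lookup Rx (∈-lookup j)
AllPairs-lookup R-sym (Rx ∷ _)   (suc i) zero    _   = R-sym (All.lookup Rx (∈-lookup i))
AllPairs-lookup R-sym (_  ∷ Rxs) (suc i) (suc j) i≢j =
  AllPairs-lookup R-sym Rxs i j (λ i≡j → i≢j (cong suc i≡j))

selectParts : ∀ {q} {P : VSet m → Set} (ps : List (VSet m)) → q ≤ length ps →
  AllPairs Disjoint ps → All P ps → Σ (Fin q → VSet m) λ S → PairwiseDisjoint S × (∀ i → P (S i))
selectParts {m = m} {q = q} ps q≤k disjoint good = S , S-disjoint , λ i → All.lookup good (∈-lookup (pick i))
  where
  pick : Fin q → Fin (length ps)
  pick i = inject≤ i q≤k
  S : Fin q → VSet m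
  S i = lookup ps (pick i)
  S-disjoint : PairwiseDisjoint S
  S-disjoint i j i≢j v (v∈i , v∈j) =
    AllPairs-lookup Disjoint-sym disjoint (pick i) (pick j)
      (λ eq → i≢j (inject≤-injective q≤k q≤k i j eq)) v v∈i v∈j

module Leaves (G : Graph) where

  leavesOf : VSet (n G) → VSet (n G)
  leavesOf A v = if A v then isLeaf G v else false

  leavesIn : VSet (n G) → ℕ
  leavesIn A = count (leavesOf A)

  leavesOf-⊆ : ∀ A → leavesOf A ⊆ A
  leavesOf-⊆ A v leaf with A v
  ... | true = refl

  leavesIn-∅ : leavesIn ∅ ≡ 0
  leavesIn-∅ = count-none (leavesOf ∅) (λ v → cong (λ x → if x then isLeaf G v else false) ∉-∅)

  leavesIn-∪ : ∀ {A B} → Disjoint A B → leavesIn (A ∪ B) ≡ leavesIn A + leavesIn B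
  leavesIn-∪ {A} {B} A#B = trans (count-cong split)
    (count-∪ (Disjoint-⊆ (leavesOf-⊆ A) (leavesOf-⊆ B) A#B))
    where
    leaf-if : ∀ a b x → (if a ∨ b then x else false) ≡ (if a then x else false) ∨ (if b then x else false)
    leaf-if true  true  x = sym (∨-idem x)
    leaf-if true  false x = sym (∨-identityʳ x)
    leaf-if false _     _ = refl
    split : leavesOf (A ∪ B) ≐ leavesOf A ∪ leavesOf B
    split v = trans (cong (λ x → if x then isLeaf G v else false) ∪-apply)
                    (trans (leaf-if (A v) (B v) (isLeaf G v)) (sym ∪-apply))

  leavesIn-⟦⟧ : ∀ r → leavesIn ⟦ r ⟧ ≤ 1
  leavesIn-⟦⟧ r = ≤-trans (count-mono (leavesOf-⊆ ⟦ r ⟧)) (≤-reflexive (count-⟦⟧ r))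

  leavesIn-⟦non-leaf⟧ : ∀ {r} → isLeaf G r ≡ false → leavesIn ⟦ r ⟧ ≡ 0
  leavesIn-⟦non-leaf⟧ {r} r-inner = count-none (leavesOf ⟦ r ⟧) none
    where
    none : ∀ v → leavesOf ⟦ r ⟧ v ≡ false
    none v with ⟦ r ⟧ v in v∈⟦r⟧
    ... | true  = subst (λ x → isLeaf G x ≡ false) (⟦⟧-elim v∈⟦r⟧) r-inner
    ... | false = refl

  leaf-degree : ∀ {v} → isLeaf G v ≡ true → degree G v ≡ 1
  leaf-degree {v} leaf with degree G v
  ... | suc zero = refl

module Walks (G : Graph) where

  infixr 5 _▸_

  walk-mono : ∀ {S S′ u v} → S ⊆ S′ → Walk G S u v → Walk G S′ u v
  walk-mono S⊆S′ (here u∈S)       = here (S⊆S′ _ u∈S)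
  walk-mono S⊆S′ (step u∈S uw wv) = step (S⊆S′ _ u∈S) uw (walk-mono S⊆S′ wv)

  _▸_ : ∀ {S u v w} → Walk G S u v → Walk G S v w → Walk G S u w
  here _       ▸ q = q
  step u∈S a p ▸ q = step u∈S a (p ▸ q)

  walk-start : ∀ {S u v} → Walk G S u v → u ∈ᵥ S
  walk-start (here u∈S)     = u∈S
  walk-start (step u∈S _ _) = u∈S

  walk-end : ∀ {S u v} → Walk G S u v → v ∈ᵥ S
  walk-end (here v∈S)   = v∈S
  walk-end (step _ _ p) = walk-end p

  walk-reverse : ∀ {S u v} → Walk G S u v → Walk G S v u
  walk-reverse (here u∈S)                 = here u∈S
  walk-reverse {u = u} (step u∈S uw p) =
    walk-reverse p ▸ step (walk-start p) (trans (Graph.sym G _ u) uw) (here u∈S)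

  exit-edge : ∀ {S u v} (P : VSet (n G)) → Walk G S u v → u ∈ᵥ P → P v ≡ false →
    Σ (Fin (n G)) λ x → Σ (Fin (n G)) λ y → x ∈ᵥ P × P y ≡ false × Adj G x y
  exit-edge P (here _) u∈P v∉P = ⊥-elim (∈-∉ u∈P v∉P)
  exit-edge {u = u} P (step {w = w} _ uw p) u∈P v∉P with P w in w∈P
  ... | true  = exit-edge P p w∈P v∉P
  ... | false = u , w , u∈P , w∈P , uw

  Reaches : Fin (n G) → VSet (n G) → Set
  Reaches r R = ∀ v → v ∈ᵥ R → Walk G R v r

  Reaches⇒connected : ∀ {r R} → Reaches r R → ConnectedOn G R
  Reaches⇒connected reach u v u∈R v∈R = reach u u∈R ▸ walk-reverse (reach v v∈R)

module RootedTrees (G : Graph) where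

  V : Set
  V = Fin (n G)

  VS : Set
  VS = VSet (n G)

  data RTree : Set where
    node : V → List RTree → RTree

  root : RTree → V
  root (node r _) = r

  vertices : RTree → VS
  forestVertices : List RTree → VS
  vertices (node r cs) = ⟦ r ⟧ ∪ forestVertices cs
  forestVertices []       = ∅
  forestVertices (c ∷ cs) = vertices c ∪ forestVertices cs

  data WellFormed : RTree → Set
  data WellFormedForest (r : V) : List RTree → Set
  data WellFormed where
    node : ∀ {r cs} → WellFormedForest r cs → WellFormed (node r cs)
  data WellFormedForest r where
    []    : WellFormedForest r []
    child : ∀ {c cs} → WellFormed c → Adj G r (root c) → vertices c r ≡ false →
            Disjoint (vertices c) (forestVertices cs) → WellFormedForest r cs →
            WellFormedForest r (c ∷ cs)

  root∈ : ∀ t → root t ∈ᵥ vertices t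
  root∈ (node r cs) = ∪-introˡ (∈-⟦⟧ r)

  root∉forest : ∀ {r cs} → WellFormedForest r cs → forestVertices cs r ≡ false
  root∉forest []                     = ∉-∅
  root∉forest (child _ _ r∉c _ wf) = ∉-∪ r∉c (root∉forest wf)

  childRoots : List RTree → VS
  childRoots []       = ∅
  childRoots (c ∷ cs) = ⟦ root c ⟧ ∪ childRoots cs

  childRoots⊆ : ∀ cs → childRoots cs ⊆ forestVertices cs
  childRoots⊆ []       = ∅-⊆
  childRoots⊆ (c ∷ cs) = ∪-⊆ (⊆-trans (⟦⟧-⊆ (root∈ c)) ⊆-∪ˡ) (⊆-trans (childRoots⊆ cs) ⊆-∪ʳ)

  count-childRoots : ∀ {r cs} → WellFormedForest r cs → count (childRoots cs) ≡ length cs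
  count-childRoots []                    = count-none (childRoots []) (λ _ → ∉-∅)
  count-childRoots {cs = c ∷ cs} (child _ _ _ c#cs wf) =
    trans (count-∪ roots-disjoint) (cong₂ _+_ (count-⟦⟧ (root c)) (count-childRoots wf))
    where
    roots-disjoint : Disjoint ⟦ root c ⟧ (childRoots cs)
    roots-disjoint = Disjoint-⊆ (⟦⟧-⊆ (root∈ c)) (childRoots⊆ cs) c#cs

  childRoots-adjacent : ∀ {r cs} → WellFormedForest r cs → childRoots cs ⊆ adj G r
  childRoots-adjacent []                    = ∅-⊆
  childRoots-adjacent {r} (child _ r~c _ _ wf) v v∈ with ∪-elim v∈
  ... | inj₁ v≡c = subst (λ x → Adj G r x) (⟦⟧-elim v≡c) r~c
  ... | inj₂ v∈cs = childRoots-adjacent wf v v∈cs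

  children≤degree : ∀ {r cs} → WellFormedForest r cs → length cs ≤ degree G r
  children≤degree {cs = cs} wf =
    ≤-trans (≤-reflexive (sym (count-childRoots wf))) (count-mono (childRoots-adjacent wf))

module SpanningTree (G : Graph) where

  open Walks G
  open RootedTrees G

  attach : ∀ {a b} → Adj G a b → ∀ t → WellFormed t → a ∈ᵥ vertices t → vertices t b ≡ false →
    Σ RTree λ t′ → WellFormed t′ × root t′ ≡ root t × vertices t′ ≐ vertices t ∪ ⟦ b ⟧
  attachForest : ∀ {a b} → Adj G a b → ∀ {r} cs → WellFormedForest r cs →
    a ∈ᵥ forestVertices cs → forestVertices cs b ≡ false → r ≢ b →
    Σ (List RTree) λ cs′ → WellFormedForest r cs′ × forestVertices cs′ ≐ forestVertices cs ∪ ⟦ b ⟧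

  attach {a} {b} a~b (node r cs) (node wf) a∈t b∉t with r F.≟ a
  ... | yes refl = node r (node b [] ∷ cs) ,
                   node (child (node []) a~b (∉-∪ (∉-⟦⟧ b≢r) ∉-∅) b#cs wf) ,
                   refl ,
                   ≐-trans (∪-cong ≐-refl (∪-cong ∪-identityʳ ≐-refl)) (≐-trans (≐-sym ∪-assoc) ∪-swap)
    where
    b≢r : b ≢ r
    b≢r refl = ∈-∉ (root∈ (node r cs)) b∉t
    b#cs : Disjoint (vertices (node b [])) (forestVertices cs)
    b#cs = Disjoint-sym (Disjoint-∪ (Disjoint-⟦⟧ (∉-∪ʳ b∉t)) Disjoint-∅)
  ... | no r≢a with attachForest a~b cs wf (∪-elimʳ a∈t (∉-⟦⟧ r≢a)) (∉-∪ʳ b∉t)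
                                 (λ { refl → ∈-∉ (root∈ (node r cs)) b∉t })
  ...   | cs′ , wf′ , added = node r cs′ , node wf′ , refl , ≐-trans (∪-cong ≐-refl added) (≐-sym ∪-assoc)

  attachForest a~b [] [] a∈ _ _ = ⊥-elim (∈-∉ a∈ ∉-∅)
  attachForest a~b (c ∷ cs) (child wfc r~c r∉c c#cs wf) a∈ b∉ r≢b with ∪-elim a∈
  ... | inj₁ a∈c with attach a~b c wfc a∈c (∉-∪ˡ b∉)
  ...   | c′ , wfc′ , same-root , added =
            c′ ∷ cs ,
            child wfc′ (subst (Adj G _) (sym same-root) r~c)
                  (trans (added _) (∉-∪ r∉c (∉-⟦⟧ (≢-sym r≢b))))
                  (Disjoint-⊆ (≐⇒⊆ added) ⊆-refl
                     (Disjoint-sym (Disjoint-∪ (Disjoint-sym c#cs) (Disjoint-⟦⟧ (∉-∪ʳ b∉)))))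
                  wf ,
            ≐-trans (∪-cong added ≐-refl) ∪-swap
  attachForest a~b (c ∷ cs) (child wfc r~c r∉c c#cs wf) a∈ b∉ r≢b
      | inj₂ a∈cs with attachForest a~b cs wf a∈cs (∉-∪ʳ b∉) r≢b
  ...   | cs′ , wf′ , added =
            c ∷ cs′ ,
            child wfc r~c r∉c
                  (Disjoint-⊆ ⊆-refl (≐⇒⊆ added) (Disjoint-∪ c#cs (Disjoint-⟦⟧ (∉-∪ˡ b∉))))
                  wf′ ,
            ≐-trans (∪-cong ≐-refl added) (≐-sym ∪-assoc)

  -- Grow a tree one vertex at a time along edges leaving it, until it spans
  -- G; the fuel bounds the number of vertices still missing.
  grow : Connected G → (fuel : ℕ) → ∀ t → WellFormed t → n G ≤ count (vertices t) + fuel →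
    Σ RTree λ t′ → WellFormed t′ × (∀ v → v ∈ᵥ vertices t′)
  grow connected fuel t wf enough with all? (λ v → vertices t v B.≟ true)
  ... | yes spanning = t , wf , spanning
  ... | no ¬spanning with ¬∀⟶∃¬ _ _ (λ v → vertices t v B.≟ true) ¬spanning
  ...   | b , b∉ with fuel
  ...     | zero = ⊥-elim (<⇒≱ too-many enough)
    where
    too-many : count (vertices t) + 0 < n G
    too-many = begin-strict
      count (vertices t) + 0     ≡⟨ +-identityʳ _ ⟩
      count (vertices t)         <⟨ n<1+n _ ⟩
      suc (count (vertices t))   ≡⟨ count-extend {A = vertices t} (¬-not b∉) ⟨
      count (vertices t ∪ ⟦ b ⟧) ≤⟨ count-≤ _ ⟩
      n G                        ∎
      where open ≤-Reasoning
  ...     | suc fuel′ with exit-edge (vertices t) (connected (root t) b refl refl) (root∈ t) (¬-not b∉)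
  ...       | x , y , x∈t , y∉t , x~y with attach x~y t wf x∈t y∉t
  ...         | t′ , wf′ , _ , added = grow connected fuel′ t′ wf′ (≤-trans enough (≤-reflexive grown))
    where
    grown : count (vertices t) + suc fuel′ ≡ count (vertices t′) + fuel′
    grown = begin
      count (vertices t) + suc fuel′     ≡⟨ +-suc _ fuel′ ⟩
      suc (count (vertices t)) + fuel′   ≡⟨ cong (_+ fuel′) (count-extend {A = vertices t} y∉t) ⟨
      count (vertices t ∪ ⟦ y ⟧) + fuel′ ≡⟨ cong (_+ fuel′) (count-cong added) ⟨
      count (vertices t′) + fuel′        ∎
      where open ≡-Reasoning

  spanningTree : Connected G → V → Σ RTree λ t → WellFormed t × (∀ v → v ∈ᵥ vertices t)
  spanningTree connected r = grow connected (n G) (node r []) (node []) (m≤n+m _ _)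

module Decomposition (G : Graph) (D : ℕ) (degree≤D : ∀ v → degree G v ≤ D) (2≤D : 2 ≤ D) where

  open Leaves G
  open Walks G
  open RootedTrees G
  open SpanningTree G

  Good : VS → Set
  Good P = IsSubtree G P × ContainsThreeLeaves G P

  record Decomposes (X : VS) (b : ℕ) (Linked : VS → Set) : Set where
    field
      parts          : List VS
      rest           : VS
      parts⊆         : All (_⊆ X) parts
      rest⊆          : rest ⊆ X
      parts-disjoint : AllPairs Disjoint parts
      rest-disjoint  : All (λ P → Disjoint P rest) parts
      parts-good     : All Good parts
      rest-linked    : Linked rest
      rest-leaves    : leavesIn rest ≤ b
      accounting     : leavesIn X ≤ 2 * D * length parts + leavesIn rest

  -- for a tree, the residual reaches the root; for the children of r it
  -- reaches r once r is added
  TreeDecomposition : RTree → Set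
  TreeDecomposition t = Decomposes (vertices t) 2 (Reaches (root t))

  ForestDecomposition : V → List RTree → Set
  ForestDecomposition r cs = Decomposes (forestVertices cs) (2 * length cs) (λ R → Reaches r (R ∪ ⟦ r ⟧))

  merge : ∀ {X Y a b P Q R} → Disjoint X Y → (∀ {A B} → P A → Q B → R (A ∪ B)) →
    Decomposes X a P → Decomposes Y b Q → Decomposes (X ∪ Y) (a + b) R
  merge {X} {Y} X#Y link DX DY = record
    { parts          = DX.parts ++ DY.parts
    ; rest           = DX.rest ∪ DY.rest
    ; parts⊆         = AllProps.++⁺ (All.map (λ P⊆X → ⊆-trans P⊆X ⊆-∪ˡ) DX.parts⊆)
                               (All.map (λ P⊆Y → ⊆-trans P⊆Y ⊆-∪ʳ) DY.parts⊆)
    ; rest⊆          = ∪-⊆ (⊆-trans DX.rest⊆ ⊆-∪ˡ) (⊆-trans DY.rest⊆ ⊆-∪ʳ)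
    ; parts-disjoint = AllPairsProps.++⁺ DX.parts-disjoint DY.parts-disjoint
                         (All.map (λ P⊆X → All.map (λ Q⊆Y → Disjoint-⊆ P⊆X Q⊆Y X#Y) DY.parts⊆) DX.parts⊆)
    ; rest-disjoint  = AllProps.++⁺
        (All.zipWith (λ (P⊆X , P#) → Disjoint-∪ P# (Disjoint-⊆ P⊆X DY.rest⊆ X#Y))
                     (DX.parts⊆ , DX.rest-disjoint))
        (All.zipWith (λ (P⊆Y , P#) → Disjoint-∪ (Disjoint-⊆ P⊆Y DX.rest⊆ (Disjoint-sym X#Y)) P#)
                     (DY.parts⊆ , DY.rest-disjoint))
    ; parts-good     = AllProps.++⁺ DX.parts-good DY.parts-good
    ; rest-linked    = link DX.rest-linked DY.rest-linked
    ; rest-leaves    = ≤-trans (≤-reflexive (leavesIn-∪ rests-disjoint)) (+-mono-≤ DX.rest-leaves DY.rest-leaves)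
    ; accounting     = begin
        leavesIn (X ∪ Y)                    ≡⟨ leavesIn-∪ X#Y ⟩
        leavesIn X + leavesIn Y             ≤⟨ +-mono-≤ DX.accounting DY.accounting ⟩
        (2 * D * length DX.parts + leavesIn DX.rest) + (2 * D * length DY.parts + leavesIn DY.rest)
          ≡⟨ regroup (2 * D) (length DX.parts) (length DY.parts) _ _ ⟩
        2 * D * (length DX.parts + length DY.parts) + (leavesIn DX.rest + leavesIn DY.rest)
          ≡⟨ cong₂ (λ k l → 2 * D * k + l) (sym (length-++ DX.parts)) (sym (leavesIn-∪ rests-disjoint)) ⟩
        2 * D * length (DX.parts ++ DY.parts) + leavesIn (DX.rest ∪ DY.rest) ∎
    }
    where
    module DX = Decomposes DX
    module DY = Decomposes DY
    open ≤-Reasoning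
    rests-disjoint : Disjoint DX.rest DY.rest
    rests-disjoint = Disjoint-⊆ DX.rest⊆ DY.rest⊆ X#Y
    regroup : ∀ d k l x y → (d * k + x) + (d * l + y) ≡ d * (k + l) + (x + y)
    regroup = solve-∀

  noChildren : ∀ r → ForestDecomposition r []
  noChildren r = record
    { parts = [] ; rest = ∅ ; parts⊆ = [] ; rest⊆ = ∅-⊆
    ; parts-disjoint = [] ; rest-disjoint = [] ; parts-good = []
    ; rest-linked = λ v v∈ → subst (Walk G (∅ ∪ ⟦ r ⟧) v) (sym (⟦⟧-elim (∪-elimʳ v∈ ∉-∅))) (here v∈)
    ; rest-leaves = ≤-reflexive leavesIn-∅
    ; accounting  = m≤n+m _ _
    }

  hang : ∀ {r c} → Adj G r (root c) → ∀ {A B} → Reaches (root c) A → Reaches r (B ∪ ⟦ r ⟧) →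
    Reaches r ((A ∪ B) ∪ ⟦ r ⟧)
  hang {r} {c} r~c {A} {B} reachA reachB v v∈ with ∪-elim v∈
  ... | inj₁ v∈A∪B with ∪-elim v∈A∪B
  ...   | inj₁ v∈A = walk-mono A⊆ p ▸ step (A⊆ _ (walk-end p)) (trans (Graph.sym G _ r) r~c)
                                            (here (∪-introʳ (∈-⟦⟧ r)))
    where
    p : Walk G A v (root c)
    p = reachA v v∈A
    A⊆ : A ⊆ (A ∪ B) ∪ ⟦ r ⟧
    A⊆ = ⊆-trans ⊆-∪ˡ ⊆-∪ˡ
  ...   | inj₂ v∈B = walk-mono B∪r⊆ (reachB v (∪-introˡ v∈B))
    where
    B∪r⊆ : B ∪ ⟦ r ⟧ ⊆ (A ∪ B) ∪ ⟦ r ⟧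
    B∪r⊆ = ∪-⊆ (⊆-trans ⊆-∪ʳ ⊆-∪ˡ) ⊆-∪ʳ
  hang {r} r~c {A} {B} reachA reachB v v∈ | inj₂ v≡r =
    subst (Walk G _ v) (sym (⟦⟧-elim v≡r)) (here v∈)

  addChild : ∀ {r c cs} → WellFormedForest r (c ∷ cs) →
    TreeDecomposition c → ForestDecomposition r cs → ForestDecomposition r (c ∷ cs)
  addChild {r} {c} {cs} (child _ r~c _ c#cs _) Dc Dcs =
    subst (λ b → Decomposes (forestVertices (c ∷ cs)) b (λ R → Reaches r (R ∪ ⟦ r ⟧)))
          (sym (*-suc 2 (length cs))) (merge c#cs (hang {r} {c} r~c) Dc Dcs)

  -- The residual of the children of r together with r carries at most 2D
  -- leaves: at most 2 per child, and a leaf r has only one child.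
  hub-leaves : ∀ {r cs R} → WellFormedForest r cs → leavesIn R ≤ 2 * length cs → R ⊆ forestVertices cs →
    leavesIn (R ∪ ⟦ r ⟧) ≤ 2 * D
  hub-leaves {r} {cs} {R} wf R-leaves R⊆ = begin
    leavesIn (R ∪ ⟦ r ⟧)           ≡⟨ leavesIn-∪ (Disjoint-⟦⟧ (∉-⊆ R⊆ (root∉forest wf))) ⟩
    leavesIn R + leavesIn ⟦ r ⟧     ≤⟨ +-monoˡ-≤ (leavesIn ⟦ r ⟧) R-leaves ⟩
    2 * length cs + leavesIn ⟦ r ⟧ ≤⟨ children-and-r ⟩
    2 * D                          ∎
    where
    open ≤-Reasoning
    children-and-r : 2 * length cs + leavesIn ⟦ r ⟧ ≤ 2 * D
    children-and-r with isLeaf G r in leaf?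
    ... | false = begin
      2 * length cs + leavesIn ⟦ r ⟧ ≡⟨ cong (2 * length cs +_) (leavesIn-⟦non-leaf⟧ leaf?) ⟩
      2 * length cs + 0              ≡⟨ +-identityʳ _ ⟩
      2 * length cs                  ≤⟨ *-monoʳ-≤ 2 (≤-trans (children≤degree wf) (degree≤D r)) ⟩
      2 * D                          ∎
    ... | true = begin
      2 * length cs + leavesIn ⟦ r ⟧ ≤⟨ +-mono-≤ (*-monoʳ-≤ 2 one-child) (leavesIn-⟦⟧ r) ⟩
      3                              ≤⟨ n≤1+n 3 ⟩
      2 * 2                          ≤⟨ *-monoʳ-≤ 2 2≤D ⟩
      2 * D                          ∎
      where
      one-child : length cs ≤ 1
      one-child = ≤-trans (children≤degree wf) (≤-reflexive (leaf-degree leaf?))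

  module AtVertex {r cs} (wf : WellFormedForest r cs) (Dcs : ForestDecomposition r cs) where

    private
      module Dcs = Decomposes Dcs

    hub : VS
    hub = Dcs.rest ∪ ⟦ r ⟧

    r∉cs : forestVertices cs r ≡ false
    r∉cs = root∉forest wf

    hub⊆ : hub ⊆ vertices (node r cs)
    hub⊆ = ∪-⊆ (⊆-trans Dcs.rest⊆ ⊆-∪ʳ) ⊆-∪ˡ

    parts⊆ : All (_⊆ vertices (node r cs)) Dcs.parts
    parts⊆ = All.map (λ P⊆ → ⊆-trans P⊆ ⊆-∪ʳ) Dcs.parts⊆

    parts#hub : All (λ P → Disjoint P hub) Dcs.parts
    parts#hub = All.zipWith (λ (P⊆ , P#) → Disjoint-∪ P# (Disjoint-⟦⟧ (∉-⊆ P⊆ r∉cs)))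
                            (Dcs.parts⊆ , Dcs.rest-disjoint)

    accounting : leavesIn (vertices (node r cs)) ≤ 2 * D * length Dcs.parts + leavesIn hub
    accounting = begin
      leavesIn (⟦ r ⟧ ∪ forestVertices cs)          ≡⟨ leavesIn-∪ (Disjoint-sym (Disjoint-⟦⟧ r∉cs)) ⟩
      leavesIn ⟦ r ⟧ + leavesIn (forestVertices cs) ≤⟨ +-monoʳ-≤ (leavesIn ⟦ r ⟧) Dcs.accounting ⟩
      leavesIn ⟦ r ⟧ + (2 * D * length Dcs.parts + leavesIn Dcs.rest)
        ≡⟨ rotate (leavesIn ⟦ r ⟧) (2 * D * length Dcs.parts) (leavesIn Dcs.rest) ⟩
      2 * D * length Dcs.parts + (leavesIn Dcs.rest + leavesIn ⟦ r ⟧)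
        ≡⟨ cong (2 * D * length Dcs.parts +_) (leavesIn-∪ (Disjoint-⟦⟧ (∉-⊆ Dcs.rest⊆ r∉cs))) ⟨
      2 * D * length Dcs.parts + leavesIn hub ∎
      where
      open ≤-Reasoning
      rotate : ∀ x y z → x + (y + z) ≡ y + (z + x)
      rotate = solve-∀

    cut : 3 ≤ leavesIn hub → TreeDecomposition (node r cs)
    cut three-leaves = record
      { parts          = hub ∷ Dcs.parts
      ; rest           = ∅
      ; parts⊆         = hub⊆ ∷ parts⊆
      ; rest⊆          = ∅-⊆
      ; parts-disjoint = All.map Disjoint-sym parts#hub ∷ Dcs.parts-disjoint
      ; rest-disjoint  = Disjoint-∅ ∷ All.map (λ _ → Disjoint-∅) Dcs.parts⊆
      ; parts-good     = (((r , ∪-introʳ (∈-⟦⟧ r)) , Reaches⇒connected Dcs.rest-linked) , three-leaves)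
                         ∷ Dcs.parts-good
      ; rest-linked    = λ v v∈∅ → ⊥-elim (∈-∉ v∈∅ ∉-∅)
      ; rest-leaves    = ≤-trans (≤-reflexive leavesIn-∅) z≤n
      ; accounting     = begin
          leavesIn (vertices (node r cs))         ≤⟨ accounting ⟩
          2 * D * length Dcs.parts + leavesIn hub ≤⟨ +-monoʳ-≤ (2 * D * length Dcs.parts) hub-bound ⟩
          2 * D * length Dcs.parts + 2 * D        ≡⟨ one-more (2 * D) (length Dcs.parts) ⟩
          2 * D * suc (length Dcs.parts) + 0      ≡⟨ cong (2 * D * suc (length Dcs.parts) +_) leavesIn-∅ ⟨
          2 * D * suc (length Dcs.parts) + leavesIn ∅ ∎
      }
      where
      open ≤-Reasoning
      hub-bound : leavesIn hub ≤ 2 * D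
      hub-bound = hub-leaves wf Dcs.rest-leaves Dcs.rest⊆
      one-more : ∀ d k → d * k + d ≡ d * suc k + 0
      one-more = solve-∀

    keep : leavesIn hub ≤ 2 → TreeDecomposition (node r cs)
    keep two-leaves = record
      { parts          = Dcs.parts
      ; rest           = hub
      ; parts⊆         = parts⊆
      ; rest⊆          = hub⊆
      ; parts-disjoint = Dcs.parts-disjoint
      ; rest-disjoint  = parts#hub
      ; parts-good     = Dcs.parts-good
      ; rest-linked    = Dcs.rest-linked
      ; rest-leaves    = two-leaves
      ; accounting     = accounting
      }

  closeVertex : ∀ {r cs} → WellFormedForest r cs → ForestDecomposition r cs → TreeDecomposition (node r cs)
  closeVertex wf Dcs with 3 ≤? leavesIn (AtVertex.hub wf Dcs)
  ... | yes three-leaves = AtVertex.cut wf Dcs three-leaves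
  ... | no fewer         = AtVertex.keep wf Dcs (≮⇒≥ fewer)

  decompose : ∀ t → WellFormed t → TreeDecomposition t
  decomposeForest : ∀ r cs → WellFormedForest r cs → ForestDecomposition r cs
  decompose (node r cs) (node wf) = closeVertex wf (decomposeForest r cs wf)
  decomposeForest r [] [] = noChildren r
  decomposeForest r (c ∷ cs) wf@(child wfc _ _ _ wfcs) =
    addChild wf (decompose c wfc) (decomposeForest r cs wfcs)

  record Packing : Set where
    field
      parts      : List VS
      disjoint   : AllPairs Disjoint parts
      good       : All Good parts
      few-leaves : leafCount G < suc (length parts) * (2 * D)

  -- In a connected graph the greedy decomposition of a spanning tree is such
  -- a packing, since s ≤ 2D·k + 2.
  greedyPacking : Connected G → V → Packing
  greedyPacking connected r with spanningTree connected r
  ... | t , wf , spanning = record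
    { parts = parts ; disjoint = parts-disjoint ; good = parts-good ; few-leaves = few-leaves }
    where
    open Decomposes (decompose t wf)
    k : ℕ
    k = length parts
    few-leaves : leafCount G < suc k * (2 * D)
    few-leaves = begin-strict
      leafCount G               ≡⟨ count-cong (λ v → cong (λ b → if b then isLeaf G v else false)
                                                            (sym (spanning v))) ⟩
      leavesIn (vertices t)     ≤⟨ accounting ⟩
      2 * D * k + leavesIn rest ≤⟨ +-monoʳ-≤ (2 * D * k) rest-leaves ⟩
      2 * D * k + 2             <⟨ +-monoʳ-< (2 * D * k) (*-monoʳ-< 2 2≤D) ⟩
      2 * D * k + 2 * D         ≡⟨ +-comm _ (2 * D) ⟩
      2 * D + 2 * D * k         ≡⟨ *-suc (2 * D) k ⟨
      2 * D * suc k             ≡⟨ *-comm (2 * D) (suc k) ⟩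
      suc k * (2 * D)           ∎
      where open ≤-Reasoning

lemma9 : (T : Graph) → IsTree T → (h : 3 ≤ maxDegree T) →
    Σ (Fin (_/_ (leafCount T) (2 * maxDegree T) {{nz2 h}}) → VSet (n T)) λ S →
    PairwiseDisjoint S × (∀ i → IsSubtree T (S i) × ContainsThreeLeaves T (S i))
lemma9 T (connected , _) 3≤Δ = selectParts parts enough-parts disjoint good
  where
  open Decomposition T (maxDegree T) (maxOver-≥ (degree T)) (≤-trans (n≤1+n 2) 3≤Δ)
  some-vertex : Fin (n T)
  some-vertex = element-of-positive-max (degree T) (≤-trans (s≤s z≤n) 3≤Δ)
  open Packing (greedyPacking connected some-vertex)
  enough-parts : _/_ (leafCount T) (2 * maxDegree T) {{nz2 3≤Δ}} ≤ length parts
  enough-parts = s≤s⁻¹ (m<n*o⇒m/o<n {{nz2 3≤Δ}} few-leaves)
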